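{- For integers $n\geq 1$ and $k\geq 0$, the map $\varphi$ is an involution on $A_{n,k}$, that is, $\varphi(\varphi(\pi))=\pi$ for every $\pi\in A_{n,k}$.
   Context: For a permutation $\pi=\pi_1\cdots\pi_n$ of $[n]=\{1,\dots,n\}$, $\mathrm{des}(\pi)$ is the number of $i\in[n-1]$ with $\pi_i>\pi_{i+1}$, and $\mathrm{maxdrop}(\pi)=\max\{i-\pi_i:1\leq i\leq n\}$. $A_{n,k}$ is the set of permutations of $[n]$ with $\mathrm{maxdrop}(\pi)\leq k$. For a permutation $\sigma$ of $[m]$ and $1\leq c\leq m+1$, $\sigma\leftarrow c$ denotes the permutation of $[m+1]$ obtained by increasing by $1$ every entry of $\sigma$ that is $\geq c$ and then appending $c$ at the end (e.g. $3421\leftarrow 3=45213$). The map $\varphi$ on $A_{n,k}$ is defined recursively: $\varphi(1)=1$ for $n=1$; for $n\geq 2$ and $\pi\in A_{n,k}$, put $i=\mathrm{des}(\pi)$, $j=\pi_n-n+k$, $i'=\lfloor((n+1)k-(k+1)i-j)/(k+1)\rfloor$, $j'=(n+1)k-(k+1)i-j-(k+1)i'$, let $\pi'$ be the permutation of $[n-1]$ order-isomorphic to $\pi_1\cdots\pi_{n-1}$ (so $\pi=\pi'\leftarrow\pi_n$), and set $\varphi(\pi)=\varphi(\pi')\leftarrow(n-k+j')$. -}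

module Defs where

open import Data.Nat as ℕ using (ℕ; zero; suc; _∸_; _⊔_; _<ᵇ_)
open import Data.Bool using (if_then_else_)
open import Data.List using (List; []; _∷_; _++_; map; length; upTo)
open import Data.Product using (_×_; _,_; proj₁; proj₂)
open import Data.Integer as ℤ using (ℤ; +_; ∣_∣; _/ℕ_)
open import Data.List.Relation.Binary.Permutation.Propositional using (_↭_)

-- A permutation π = π₁⋯πₙ of [n] is represented as the list [π₁, …, πₙ].

[1‥_] : ℕ → List ℕ
[1‥ n ] = map suc (upTo n)

IsPerm : ℕ → List ℕ → Set
IsPerm n π = π ↭ [1‥ n ]

des : List ℕ → ℕ
des []           = 0
des (x ∷ [])     = 0
des (x ∷ y ∷ xs) = (if y <ᵇ x then 1 else 0) ℕ.+ des (y ∷ xs)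

-- maxdrop(π) = max { i - πᵢ }.  We compute it in ℕ with truncated subtraction
-- and base value 0; for a permutation of [n] with n ≥ 1 this agrees with the
-- integer maximum, since Σ (i - πᵢ) = 0 forces the maximum to be ≥ 0.
maxdropFrom : ℕ → List ℕ → ℕ
maxdropFrom i []       = 0
maxdropFrom i (x ∷ xs) = (i ∸ x) ⊔ maxdropFrom (suc i) xs

maxdrop : List ℕ → ℕ
maxdrop π = maxdropFrom 1 π

InA : ℕ → ℕ → List ℕ → Set
InA n k π = IsPerm n π × maxdrop π ℕ.≤ k

_←_ : List ℕ → ℕ → List ℕ
σ ← c = map (λ x → if x <ᵇ c then x else suc x) σ ++ (c ∷ [])

initLast : List ℕ → List ℕ × ℕ
initLast []       = [] , 0
initLast (x ∷ []) = [] , x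
initLast (x ∷ y ∷ xs) with initLast (y ∷ xs)
... | (ys , l) = (x ∷ ys) , l

-- the permutation of [n-1] order-isomorphic to π₁⋯πₙ₋₁ when π is a
-- permutation of [n] with last entry c: decrease every entry > c by 1
-- (so that π = π' ← πₙ)
standardize : List ℕ → ℕ → List ℕ
standardize σ c = map (λ x → if c <ᵇ x then x ∸ 1 else x) σ

-- the new last entry n - k + j' (computed in ℤ; i' is the floor quotient)
newLast : (n k : ℕ) → List ℕ → ℕ → ℕ
newLast n k π πn = ∣ + n ℤ.- + k ℤ.+ j' ∣
  where
  i  : ℤ
  i  = + des π
  j  : ℤ
  j  = + πn ℤ.- + n ℤ.+ + k
  X  : ℤ
  X  = + ((suc n) ℕ.* k) ℤ.- + (suc k) ℤ.* i ℤ.- j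
  i' : ℤ
  i' = X /ℕ (suc k)
  j' : ℤ
  j' = X ℤ.- + (suc k) ℤ.* i'

φAux : (k n : ℕ) → List ℕ → List ℕ
φAux k zero          π = π
φAux k (suc zero)    π = 1 ∷ []
φAux k (suc (suc m)) π =
  φAux k (suc m) (standardize (proj₁ (initLast π)) (proj₂ (initLast π)))
    ← newLast (suc (suc m)) k π (proj₂ (initLast π))

φ : ℕ → List ℕ → List ℕ
φ k π = φAux k (length π) π

module Submission where

-- For π ∈ A_{n,k} with d descents and last entry y, the paper's quantity
-- X = (n+1)k − (k+1)d − (y − n + k) is nonnegative and its division by k+1 gives (i′, j′).
-- By induction on n, φ(π) has i′ descents and ends in n − k + j′: passing from the
-- standardized prefix π′ to π adds to X some e ∈ [0, k], and φ(π) = φ(π′) ← c gets a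
-- final descent exactly when adding e carries into the quotient. The relation between
-- (d, y) and (i′, j′) is symmetric, so the last entry of φ(φ(π)) is y again; as φ(π)
-- standardizes to φ(π′), induction gives φ(φ(π)) = φ(φ(π′)) ← y = π′ ← y = π.

open import Defs
open import Data.Bool using (Bool; true; false; if_then_else_)
open import Data.Empty using (⊥-elim)
open import Data.Unit using (⊤)
import Data.Integer as ℤ
import Data.Integer.Properties as ℤₚ
import Data.Integer.Tactic.RingSolver as ℤ-Solver
open import Data.List as List using (List; []; _∷_; _++_; _∷ʳ_; map; length; upTo; _∷ʳ′_)
open import Data.List.Properties using (length-++; length-map; map-++; map-∘; map-cong; map-id; map-id-local; length-upTo)
open import Data.List.Membership.Propositional.Properties using (∈-upTo⁻)
open import Data.List.Relation.Binary.Permutation.Propositional using (↭-sym; ↭⇒↭ₛ)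
open import Data.List.Relation.Binary.Permutation.Propositional.Properties using (↭-length; All-resp-↭)
import Data.List.Relation.Binary.Permutation.Setoid.Properties as Permutationₛ
open import Data.List.Relation.Unary.All as All using (All)
import Data.List.Relation.Unary.All.Properties as All
open import Data.List.Relation.Unary.Unique.Propositional using (Unique)
import Data.List.Relation.Unary.Unique.Propositional.Properties as Unique
open import Data.Nat using (ℕ; zero; suc; _+_; _*_; _∸_; _⊔_; _≤_; _<_; _<ᵇ_; z≤n; s≤s; z<s; _<?_; _≤?_)
open import Data.Nat.DivMod using (_/_; _%_; m<n⇒m%n≡m; [m+kn]%n≡m%n; m*n%n≡0; +-distrib-/-∣ʳ; m<n⇒m/n≡0; m*n/n≡m)
open import Data.Nat.Divisibility using (n∣m*n)
open import Data.Nat.Properties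
import Data.Nat.Tactic.RingSolver as ℕ-Solver
open import Data.Product using (∃; ∃₂; _×_; _,_; proj₁; proj₂)
open import Function using (_∘_)
open import Relation.Binary.Definitions using (tri<; tri≈; tri>)
open import Relation.Binary.PropositionalEquality
open import Relation.Nullary using (¬_; yes; no)
open import Relation.Nullary.Reflects using (ofʸ; ofⁿ; det; fromEquivalence)

iverson : Bool → ℕ
iverson b = if b then 1 else 0

<ᵇ-true : ∀ {m n} → m < n → (m <ᵇ n) ≡ true
<ᵇ-true {m} {n} m<n = det (<ᵇ-reflects-< m n) (ofʸ m<n)

<ᵇ-false : ∀ {m n} → ¬ m < n → (m <ᵇ n) ≡ false
<ᵇ-false {m} {n} m≮n = det (<ᵇ-reflects-< m n) (ofⁿ m≮n)

<ᵇ-cong : ∀ {a b c d} → (a < b → c < d) → (c < d → a < b) → (a <ᵇ b) ≡ (c <ᵇ d)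
<ᵇ-cong {a} {b} {c} {d} f g =
  det (<ᵇ-reflects-< a b) (fromEquivalence (g ∘ <ᵇ⇒< c d) (<⇒<ᵇ ∘ f))

<ᵇ-preserved : ∀ {P : ℕ → Set} {f : ℕ → ℕ} →
               (∀ {a b} → P a → P b → a < b → f a < f b) →
               ∀ {a b} → P a → P b → (f a <ᵇ f b) ≡ (a <ᵇ b)
<ᵇ-preserved {f = f} mono {a} {b} pa pb = <ᵇ-cong reflect (mono pa pb)
  where
  reflect : f a < f b → a < b
  reflect fa<fb with <-cmp a b
  ... | tri< a<b _ _ = a<b
  ... | tri≈ _ refl _ = ⊥-elim (<-irrefl refl fa<fb)
  ... | tri> _ _ b<a = ⊥-elim (<-asym fa<fb (mono pb pa b<a))

retraction-strictMonoOn : ∀ {P : ℕ → Set} {f g : ℕ → ℕ} →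
                          (∀ {a b} → a < b → g a < g b) → (∀ {a} → P a → g (f a) ≡ a) →
                          ∀ {a b} → P a → P b → a < b → f a < f b
retraction-strictMonoOn {f = f} {g} mono inv {a} {b} pa pb a<b with <-cmp (f a) (f b)
... | tri< fa<fb _ _ = fa<fb
... | tri≈ _ fa≡fb _ = ⊥-elim (<-irrefl (trans (sym (inv pa)) (trans (cong g fa≡fb) (inv pb))) a<b)
... | tri> _ _ fb<fa = ⊥-elim (<-asym a<b (subst₂ _<_ (inv pb) (inv pa) (mono fb<fa)))

raise : ℕ → ℕ → ℕ
raise c x = if x <ᵇ c then x else suc x

lower : ℕ → ℕ → ℕ
lower c x = if c <ᵇ x then x ∸ 1 else x

raise-< : ∀ {c x} → x < c → raise c x ≡ x
raise-< x<c rewrite <ᵇ-true x<c = refl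

raise-≥ : ∀ {c x} → c ≤ x → raise c x ≡ suc x
raise-≥ c≤x rewrite <ᵇ-false (≤⇒≯ c≤x) = refl

lower-≤ : ∀ {c x} → x ≤ c → lower c x ≡ x
lower-≤ x≤c rewrite <ᵇ-false (≤⇒≯ x≤c) = refl

lower-> : ∀ {c x} → c < x → lower c x ≡ x ∸ 1
lower-> c<x rewrite <ᵇ-true c<x = refl

lower-raise : ∀ c x → lower c (raise c x) ≡ x
lower-raise c x with x <? c
... | yes x<c = trans (cong (lower c) (raise-< x<c)) (lower-≤ (<⇒≤ x<c))
... | no  x≮c = trans (cong (lower c) (raise-≥ (≮⇒≥ x≮c))) (lower-> (s≤s (≮⇒≥ x≮c)))

raise-lower : ∀ {c x} → x ≢ c → raise c (lower c x) ≡ x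
raise-lower {c} {x} x≢c with <-cmp x c
... | tri< x<c _ _ = trans (cong (raise c) (lower-≤ (<⇒≤ x<c))) (raise-< x<c)
... | tri≈ _ x≡c _ = ⊥-elim (x≢c x≡c)
... | tri> _ _ c<x = trans (cong (raise c) (lower-> c<x)) (raise-pred c<x)
  where
  raise-pred : ∀ {x} → c < x → raise c (x ∸ 1) ≡ x
  raise-pred {suc x} (s≤s c≤x) = raise-≥ c≤x

raise-strictMono : ∀ {c a b} → a < b → raise c a < raise c b
raise-strictMono {c} {a} {b} a<b with a <? c | b <? c
... | yes a<c | yes b<c rewrite raise-< a<c | raise-< b<c = a<b
... | yes a<c | no  b≮c rewrite raise-< a<c | raise-≥ (≮⇒≥ b≮c) = m<n⇒m<1+n a<b
... | no  a≮c | yes b<c = ⊥-elim (a≮c (<-trans a<b b<c))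
... | no  a≮c | no  b≮c rewrite raise-≥ (≮⇒≥ a≮c) | raise-≥ (≮⇒≥ b≮c) = s≤s a<b

lower-strictMonoOn : ∀ {c a b} → a ≢ c → b ≢ c → a < b → lower c a < lower c b
lower-strictMonoOn {c} = retraction-strictMonoOn {f = lower c} {raise c} (raise-strictMono {c}) raise-lower

raise-self-<ᵇ : ∀ c x → (c <ᵇ raise c x) ≡ (c <ᵇ suc x)
raise-self-<ᵇ c x with x <? c
... | yes x<c rewrite raise-< x<c = trans (<ᵇ-false (<-asym x<c)) (sym (<ᵇ-false (≤⇒≯ x<c)))
... | no  x≮c rewrite raise-≥ (≮⇒≥ x≮c) = refl

standardize-raise : ∀ c σ → standardize (map (raise c) σ) c ≡ σ
standardize-raise c σ = trans (sym (map-∘ σ)) (trans (map-cong (lower-raise c) σ) (map-id σ))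

raise-standardize : ∀ {c xs} → All (_≢ c) xs → map (raise c) (standardize xs c) ≡ xs
raise-standardize {xs = xs} xs≢c = trans (sym (map-∘ xs)) (map-id-local (All.map raise-lower xs≢c))

standardize-∷ʳ : ∀ xs x y → standardize (xs ∷ʳ x) y ≡ standardize xs y ∷ʳ lower y x
standardize-∷ʳ xs x y = map-++ (lower y) xs (x ∷ [])

-- Adding up the hypotheses as a ≡ b leaves a ring identity for the solver.
cancel-≡ : ∀ {a b c d : ℕ} → a ≡ b → c + b ≡ d + a → c ≡ d
cancel-≡ {a} {b} {c} {d} a≡b eq = +-cancelʳ-≡ b c d (trans eq (cong (d +_) a≡b))

module Arithmetic (k : ℕ) where

  -- For a permutation of [n] with d descents and last entry y:
  -- (n+1)k − (k+1)d − (y − n + k) = (k+1)q + r, moved so that no subtraction occurs.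
  record Balanced (n d y q r : ℕ) : Set where
    constructor balanced
    field equation : r + q * suc k + (d * suc k + y + k) ≡ suc n * k + n

  balanced-swap : ∀ {n d y q r c j} → Balanced n d y q r → c + k ≡ n + r → j + n ≡ y + k →
                  Balanced n q c d j
  balanced-swap {n} {d} {y} {q} {r} {c} {j} (balanced bal) c+k j+n = balanced
    (cancel-≡ (cong₂ _+_ (cong₂ _+_ bal c+k) j+n) (ℕ-Solver.solve (k ∷ n ∷ d ∷ y ∷ q ∷ r ∷ c ∷ j ∷ [])))

  balanced-step : ∀ {n d x q₀ r₀ q r e b y} → Balanced (suc n) d x q₀ r₀ →
                  r + q * suc k ≡ r₀ + q₀ * suc k + e → e + b * suc k + y ≡ x + suc k →
                  Balanced (suc (suc n)) (d + b) y q r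
  balanced-step {n} {d} {x} {q₀} {r₀} {q} {r} {e} {b} {y} (balanced bal) qr-eq e-eq = balanced
    (cancel-≡ (cong₂ _+_ (cong₂ _+_ bal qr-eq) e-eq)
              (ℕ-Solver.solve (k ∷ n ∷ d ∷ x ∷ q₀ ∷ r₀ ∷ q ∷ r ∷ e ∷ b ∷ y ∷ [])))

  k≤n+r : ∀ {n d y q r} → Balanced n d y q r → 1 ≤ y → y ≤ n → k ≤ n + r
  k≤n+r {n} {d} {y} {q} {r} (balanced bal) 1≤y y≤n = ≮⇒≥ λ n+r<k →
    <⇒≢ (≤-trans 1≤y (m≤n+m y r)) (sym (r+y≡0 n+r<k))
    where
    multiple : r + y + (q + d + 1) * suc k ≡ suc n * suc k
    multiple = cancel-≡ bal (ℕ-Solver.solve (k ∷ n ∷ d ∷ y ∷ q ∷ r ∷ []))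
    r+y≡0 : n + r < k → r + y ≡ 0
    r+y≡0 n+r<k = begin
      r + y                             ≡⟨ m<n⇒m%n≡m r+y<1+k ⟨
      (r + y) % suc k                       ≡⟨ [m+kn]%n≡m%n (r + y) (q + d + 1) (suc k) ⟨
      (r + y + (q + d + 1) * suc k) % suc k     ≡⟨ cong (_% suc k) multiple ⟩
      suc n * suc k % suc k                     ≡⟨ m*n%n≡0 (suc n) (suc k) ⟩
      0                                 ∎
      where
      open ≡-Reasoning
      r+y<1+k : r + y < suc k
      r+y<1+k = s≤s (≤-trans (+-monoʳ-≤ r y≤n) (subst (_≤ k) (+-comm n r) (<⇒≤ n+r<k)))

  carry : ∀ {q₀ r₀ e} → r₀ ≤ k → e ≤ k →
          ∃ λ r → r ≤ k × r + (q₀ + iverson (r <ᵇ r₀)) * suc k ≡ r₀ + q₀ * suc k + e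
  carry {q₀} {r₀} {e} r₀≤k e≤k with r₀ + e ≤? k
  ... | yes fits = r₀ + e , fits , (begin
    r₀ + e + (q₀ + iverson (r₀ + e <ᵇ r₀)) * suc k ≡⟨ cong (λ b → r₀ + e + (q₀ + iverson b) * suc k) (<ᵇ-false (≤⇒≯ (m≤m+n r₀ e))) ⟩
    r₀ + e + (q₀ + 0) * suc k                      ≡⟨ ℕ-Solver.solve (k ∷ q₀ ∷ r₀ ∷ e ∷ []) ⟩
    r₀ + q₀ * suc k + e                            ∎)
    where open ≡-Reasoning
  ... | no overflow with r , 1+k+r≡r₀+e ← m≤n⇒∃[o]m+o≡n (≰⇒> overflow) = r , r≤k , (begin
    r + (q₀ + iverson (r <ᵇ r₀)) * suc k ≡⟨ cong (λ b → r + (q₀ + iverson b) * suc k) (<ᵇ-true r<r₀) ⟩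
    r + (q₀ + 1) * suc k                 ≡⟨ cancel-≡ 1+k+r≡r₀+e (ℕ-Solver.solve (k ∷ q₀ ∷ r₀ ∷ e ∷ r ∷ [])) ⟩
    r₀ + q₀ * suc k + e                  ∎)
    where
    open ≡-Reasoning
    r≤k : r ≤ k
    r≤k = +-cancelˡ-≤ (suc k) r k (≤-trans (≤-reflexive 1+k+r≡r₀+e) (≤-trans (+-mono-≤ r₀≤k e≤k) (n≤1+n (k + k))))
    r<r₀ : r < r₀
    r<r₀ = +-cancelʳ-≤ k (suc r) r₀ (subst (_≤ r₀ + k) (cong suc (+-comm k r))
             (≤-trans (≤-reflexive 1+k+r≡r₀+e) (+-monoʳ-≤ r₀ e≤k)))

  -- X(π) = X(π′) + e when π ends in x, y and its standardized prefix π′ ends in lower y x.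
  last-increment : ∀ {x y} → x ≢ y → lower y x < y + k → y ≤ suc (lower y x + k) →
                   ∃ λ e → e ≤ k × e + iverson (y <ᵇ x) * suc k + y ≡ lower y x + suc k
  last-increment {x} {y} x≢y x′<y+k y≤ with y <ᵇ x | <ᵇ-reflects-< y x
  ... | true | ofʸ y<x with e , y+e≡x′ ← m≤n⇒∃[o]m+o≡n (∸-monoˡ-≤ 1 y<x) =
    e , +-cancelˡ-≤ y e k (≤-trans (≤-reflexive y+e≡x′) (<⇒≤ x′<y+k)) ,
    cancel-≡ y+e≡x′ (ℕ-Solver.solve (k ∷ e ∷ y ∷ x ∷ []))
  ... | false | ofⁿ y≮x with e , y+e≡x+1+k ← m≤n⇒∃[o]m+o≡n y≤ =
    e , +-cancelˡ-≤ y e k (≤-trans (≤-reflexive y+e≡x+1+k) (+-monoˡ-≤ k x<y)) ,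
    cancel-≡ y+e≡x+1+k (ℕ-Solver.solve (k ∷ e ∷ y ∷ x ∷ []))
    where
    x<y : x < y
    x<y = ≤∧≢⇒< (≮⇒≥ y≮x) x≢y

  balanced-successor : ∀ {n d q₀ r₀ x y} → Balanced (suc n) d (lower y x) q₀ r₀ → r₀ ≤ k → x ≢ y →
                       lower y x < y + k → y ≤ suc (lower y x + k) →
                       ∃ λ r → r ≤ k × Balanced (suc (suc n)) (d + iverson (y <ᵇ x)) y (q₀ + iverson (r <ᵇ r₀)) r
  balanced-successor {q₀ = q₀} bal r₀≤k x≢y x′<y+k y≤
    with e , e≤k , e-eq ← last-increment x≢y x′<y+k y≤
    with r , r≤k , r-eq ← carry {q₀} r₀≤k e≤k
    = r , r≤k , balanced-step bal r-eq e-eq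

  balanced-one : Balanced 1 0 1 0 k
  balanced-one = balanced (ℕ-Solver.solve (k ∷ []))

  newLast-balanced : ∀ {n y q r} π → Balanced n (des π) y q r → r ≤ k → k ≤ n + r →
                     newLast n k π y + k ≡ n + r
  newLast-balanced {n} {y} {q} {r} π (balanced bal) r≤k k≤n+r = begin
    newLast n k π y + k ≡⟨ cong (_+ k) newLast≡ ⟩
    n + r ∸ k + k       ≡⟨ m∸n+n≡m k≤n+r ⟩
    n + r               ∎
    where
    open ≡-Reasoning
    open ℤ using (ℤ; +_; ∣_∣; _-_; _/ℕ_)
    K : ℕ
    K = suc k
    X : ℤ
    X = + (suc n * k) - + K ℤ.* + des π - (+ y - + n ℤ.+ + k)
    X≡ : X ≡ + (r + q * K)
    X≡ = begin
      X                                  ≡⟨ rearrange (+ (suc n * k)) (+ K) (+ des π) (+ y) (+ n) (+ k) ⟩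
      + (suc n * k) ℤ.+ + n - S          ≡⟨ cong (_- S) balℤ ⟨
      + (r + q * K) ℤ.+ S - S            ≡⟨ add-sub (+ (r + q * K)) S ⟩
      + (r + q * K)                      ∎
      where
      S : ℤ
      S = + des π ℤ.* + K ℤ.+ + y ℤ.+ + k
      balℤ : + (r + q * K) ℤ.+ S ≡ + (suc n * k) ℤ.+ + n
      balℤ = subst (λ z → + (r + q * K) ℤ.+ (z ℤ.+ + y ℤ.+ + k) ≡ + (suc n * k) ℤ.+ + n)
                   (ℤₚ.pos-* (des π) K) (cong +_ bal)
      rearrange : ∀ P L D Y N M → P - L ℤ.* D - (Y - N ℤ.+ M) ≡ P ℤ.+ N - (D ℤ.* L ℤ.+ Y ℤ.+ M)
      rearrange = ℤ-Solver.solve-∀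
      add-sub : ∀ A B → A ℤ.+ B - B ≡ A
      add-sub = ℤ-Solver.solve-∀
    remainder : X - + K ℤ.* (X /ℕ K) ≡ + r
    remainder = begin
      X - + K ℤ.* (X /ℕ K)                      ≡⟨ cong (λ Z → Z - + K ℤ.* (Z /ℕ K)) X≡ ⟩
      + (r + q * K) - + K ℤ.* + ((r + q * K) / K) ≡⟨ cong (λ z → + (r + q * K) - + K ℤ.* + z) quotient ⟩
      + r ℤ.+ + (q * K) - + K ℤ.* + q           ≡⟨ cong (λ z → + r ℤ.+ z - + K ℤ.* + q) (ℤₚ.pos-* q K) ⟩
      + r ℤ.+ + q ℤ.* + K - + K ℤ.* + q         ≡⟨ cancel (+ r) (+ q) (+ K) ⟩
      + r                                       ∎
      where
      quotient : (r + q * K) / K ≡ q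
      quotient = trans (+-distrib-/-∣ʳ r (n∣m*n q)) (cong₂ _+_ (m<n⇒m/n≡0 (s≤s r≤k)) (m*n/n≡m q K))
      cancel : ∀ R Q L → R ℤ.+ Q ℤ.* L - L ℤ.* Q ≡ R
      cancel = ℤ-Solver.solve-∀
    newLast≡ : newLast n k π y ≡ n + r ∸ k
    newLast≡ = begin
      ∣ + n - + k ℤ.+ (X - + K ℤ.* (X /ℕ K)) ∣ ≡⟨ cong (λ j → ∣ + n - + k ℤ.+ j ∣) remainder ⟩
      ∣ + n - + k ℤ.+ + r ∣                    ≡⟨ cong ∣_∣ (swap (+ n) (+ k) (+ r)) ⟩
      ∣ + (n + r) - + k ∣                      ≡⟨ cong ∣_∣ (trans (ℤₚ.m-n≡m⊖n (n + r) k) (ℤₚ.⊖-≥ k≤n+r)) ⟩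
      n + r ∸ k                                ∎
      where
      swap : ∀ N M R → N - M ℤ.+ R ≡ N ℤ.+ R - M
      swap = ℤ-Solver.solve-∀

  last-comparison : ∀ {n a b r s} → a + k ≡ suc n + r → b + k ≡ n + s → (a <ᵇ suc b) ≡ (r <ᵇ s)
  last-comparison {n} {a} {b} {r} {s} a+k b+k = <ᵇ-cong to from
    where
    to : a < suc b → r < s
    to (s≤s a≤b) = +-cancelˡ-≤ n (suc r) s
      (subst (_≤ n + s) (sym (+-suc n r)) (subst₂ _≤_ a+k b+k (+-monoˡ-≤ k a≤b)))
    from : r < s → a < suc b
    from r<s = s≤s (+-cancelʳ-≤ k a b
      (subst₂ _≤_ (sym a+k) (sym b+k) (subst (_≤ n + s) (+-suc n r) (+-monoʳ-≤ n r<s))))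

  newLast-involutive : ∀ {n d y q r c} σ → des σ ≡ q → Balanced n d y q r → c + k ≡ n + r →
                       y ≤ n → n ≤ y + k → newLast n k σ c ≡ y
  newLast-involutive {n} {d} {y} {q} {r} {c} σ des-σ bal c+k y≤n n≤y+k
    with j , n+j≡y+k ← m≤n⇒∃[o]m+o≡n n≤y+k =
    +-cancelʳ-≡ k (newLast n k σ c) y (trans (newLast-balanced σ bal′ j≤k k≤n+j) n+j≡y+k)
    where
    bal′ : Balanced n (des σ) c d j
    bal′ = subst (λ t → Balanced n t c d j) (sym des-σ) (balanced-swap bal c+k (trans (+-comm j n) n+j≡y+k))
    j≤k : j ≤ k
    j≤k = +-cancelˡ-≤ n j k (≤-trans (≤-reflexive n+j≡y+k) (+-monoˡ-≤ k y≤n))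
    k≤n+j : k ≤ n + j
    k≤n+j = subst (k ≤_) (sym n+j≡y+k) (m≤n+m k y)

-- Opened only here: these constructors would make the solver's variable lists above ambiguous.
open import Data.List.Relation.Unary.All using ([]; _∷_)
open import Data.List.Relation.Unary.AllPairs using ([]; _∷_)

length-∷ʳ : ∀ (xs : List ℕ) y → length (xs ∷ʳ y) ≡ suc (length xs)
length-∷ʳ xs y = trans (length-++ xs) (+-comm (length xs) 1)

length-← : ∀ σ c → length (σ ← c) ≡ suc (length σ)
length-← σ c = trans (length-∷ʳ (map (raise c) σ) c) (cong suc (length-map (raise c) σ))

snoc-view : ∀ {n} (π : List ℕ) → length π ≡ suc n → ∃₂ λ xs y → π ≡ xs ∷ʳ y
snoc-view π _ with List.initLast π
snoc-view .[] () | []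
... | xs ∷ʳ′ y = xs , y , refl

des-map : ∀ {P : ℕ → Set} {f : ℕ → ℕ} → (∀ {a b} → P a → P b → a < b → f a < f b) →
          ∀ {ρ} → All P ρ → des (map f ρ) ≡ des ρ
des-map mono {[]}        []                = refl
des-map mono {_ ∷ []}    (_ ∷ [])          = refl
des-map mono {_ ∷ _ ∷ _} (px ∷ py ∷ pρ) =
  cong₂ _+_ (cong iverson (<ᵇ-preserved mono py px)) (des-map mono (py ∷ pρ))

des-∷ʳ-∷ʳ : ∀ ρ a b → des (ρ ∷ʳ a ∷ʳ b) ≡ des (ρ ∷ʳ a) + iverson (b <ᵇ a)
des-∷ʳ-∷ʳ []          a b = +-comm (iverson (b <ᵇ a)) 0
des-∷ʳ-∷ʳ (x ∷ [])    a b =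
  trans (cong (iverson (a <ᵇ x) +_) (des-∷ʳ-∷ʳ [] a b)) (sym (+-assoc (iverson (a <ᵇ x)) 0 _))
des-∷ʳ-∷ʳ (x ∷ y ∷ ρ) a b =
  trans (cong (iverson (y <ᵇ x) +_) (des-∷ʳ-∷ʳ (y ∷ ρ) a b)) (sym (+-assoc (iverson (y <ᵇ x)) _ _))

des-←-∷ʳ : ∀ τ a c → des ((τ ∷ʳ a) ← c) ≡ des (τ ∷ʳ a) + iverson (c <ᵇ raise c a)
des-←-∷ʳ τ a c = begin
  des ((τ ∷ʳ a) ← c)                                          ≡⟨ cong (λ ρ → des (ρ ∷ʳ c)) (map-++ (raise c) τ (a ∷ [])) ⟩
  des (map (raise c) τ ∷ʳ raise c a ∷ʳ c)                     ≡⟨ des-∷ʳ-∷ʳ (map (raise c) τ) (raise c a) c ⟩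
  des (map (raise c) τ ∷ʳ raise c a) + iverson (c <ᵇ raise c a) ≡⟨ cong (_+ iverson (c <ᵇ raise c a)) raised ⟩
  des (τ ∷ʳ a) + iverson (c <ᵇ raise c a)                     ∎
  where
  open ≡-Reasoning
  raised : des (map (raise c) τ ∷ʳ raise c a) ≡ des (τ ∷ʳ a)
  raised = trans (cong des (sym (map-++ (raise c) τ (a ∷ []))))
                 (des-map {P = λ _ → ⊤} (λ _ _ → raise-strictMono {c}) (All.universal _ (τ ∷ʳ a)))

des-standardize-∷ʳ : ∀ xs x y → All (_≢ y) (xs ∷ʳ x) →
                     des (xs ∷ʳ x ∷ʳ y) ≡ des (standardize xs y ∷ʳ lower y x) + iverson (y <ᵇ x)
des-standardize-∷ʳ xs x y ≢y = begin
  des (xs ∷ʳ x ∷ʳ y)                                     ≡⟨ des-∷ʳ-∷ʳ xs x y ⟩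
  des (xs ∷ʳ x) + iverson (y <ᵇ x)                       ≡⟨ cong (_+ iverson (y <ᵇ x)) (des-map lower-strictMonoOn ≢y) ⟨
  des (standardize (xs ∷ʳ x) y) + iverson (y <ᵇ x)       ≡⟨ cong (λ ρ → des ρ + iverson (y <ᵇ x)) (standardize-∷ʳ xs x y) ⟩
  des (standardize xs y ∷ʳ lower y x) + iverson (y <ᵇ x) ∎
  where open ≡-Reasoning

maxdropFrom-++ : ∀ s xs ys → maxdropFrom s (xs ++ ys) ≡ maxdropFrom s xs ⊔ maxdropFrom (s + length xs) ys
maxdropFrom-++ s []       ys = cong (λ t → maxdropFrom t ys) (sym (+-identityʳ s))
maxdropFrom-++ s (x ∷ xs) ys = begin
  (s ∸ x) ⊔ maxdropFrom (suc s) (xs ++ ys)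
    ≡⟨ cong ((s ∸ x) ⊔_) (maxdropFrom-++ (suc s) xs ys) ⟩
  (s ∸ x) ⊔ (maxdropFrom (suc s) xs ⊔ maxdropFrom (suc s + length xs) ys)
    ≡⟨ sym (⊔-assoc (s ∸ x) _ _) ⟩
  (s ∸ x) ⊔ maxdropFrom (suc s) xs ⊔ maxdropFrom (suc s + length xs) ys
    ≡⟨ cong (λ t → (s ∸ x) ⊔ maxdropFrom (suc s) xs ⊔ maxdropFrom t ys) (sym (+-suc s (length xs))) ⟩
  (s ∸ x) ⊔ maxdropFrom (suc s) xs ⊔ maxdropFrom (s + suc (length xs)) ys ∎
  where open ≡-Reasoning

maxdrop-∷ʳ : ∀ {k} xs y → maxdrop (xs ∷ʳ y) ≤ k → maxdrop xs ≤ k × suc (length xs) ∸ y ≤ k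
maxdrop-∷ʳ {k} xs y md
  with md′ ← subst (_≤ k) (maxdropFrom-++ 1 xs (y ∷ [])) md
  = m⊔n≤o⇒m≤o (maxdrop xs) _ md′ , m⊔n≤o⇒m≤o (suc (length xs) ∸ y) 0 (m⊔n≤o⇒n≤o (maxdrop xs) _ md′)

drop-lower : ∀ {i j k x y} → i < j → j ∸ y ≤ k → i ∸ x ≤ k → i ∸ lower y x ≤ k
drop-lower {i} {j} {k} {x} {y} i<j j∸y≤k i∸x≤k with y <? x
... | yes y<x = subst (λ z → i ∸ z ≤ k) (sym (lower-> y<x))
                  (≤-trans (∸-monoʳ-≤ i (∸-monoˡ-≤ 1 y<x)) (≤-trans (∸-monoˡ-≤ y (<⇒≤ i<j)) j∸y≤k))
... | no  y≮x = subst (λ z → i ∸ z ≤ k) (sym (lower-≤ (≮⇒≥ y≮x))) i∸x≤k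

maxdropFrom-standardize : ∀ {k y} s xs → s + length xs ∸ y ≤ k → maxdropFrom s xs ≤ k →
                          maxdropFrom s (standardize xs y) ≤ k
maxdropFrom-standardize s []       _     _  = z≤n
maxdropFrom-standardize {k} {y} s (x ∷ xs) end≤k md =
  ⊔-lub (drop-lower {x = x} (m<m+n s z<s) end≤k (m⊔n≤o⇒m≤o (s ∸ x) _ md))
        (maxdropFrom-standardize (suc s) xs (subst (λ t → t ∸ y ≤ k) (+-suc s (length xs)) end≤k)
                                             (m⊔n≤o⇒n≤o (s ∸ x) _ md))

InRange : ℕ → ℕ → Set
InRange n x = 1 ≤ x × x ≤ n

record Admissible (n k : ℕ) (π : List ℕ) : Set where
  field
    length≡  : length π ≡ n
    inRange  : All (InRange n) π
    distinct : Unique π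
    maxdrop≤ : maxdrop π ≤ k

InA⇒Admissible : ∀ {n k π} → InA n k π → Admissible n k π
InA⇒Admissible {n} {k} {π} (π↭ , maxdrop≤) = record
  { length≡  = trans (↭-length π↭) (trans (length-map suc (upTo n)) (length-upTo n))
  ; inRange  = All-resp-↭ (↭-sym π↭) (All.map⁺ (All.tabulate (λ i∈ → s≤s z≤n , ∈-upTo⁻ i∈)))
  ; distinct = Permutationₛ.Unique-resp-↭ (setoid ℕ) (↭⇒↭ₛ (↭-sym π↭))
                 (Unique.map⁺ suc-injective (Unique.upTo⁺ n))
  ; maxdrop≤ = maxdrop≤
  }

unique-∷ʳ⁻ : ∀ (xs : List ℕ) {y} → Unique (xs ∷ʳ y) → Unique xs × All (_≢ y) xs
unique-∷ʳ⁻ []       _          = [] , []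
unique-∷ʳ⁻ (x ∷ xs) (x∉ ∷ xs!) with xs!′ , xs≢y ← unique-∷ʳ⁻ xs xs! =
  All.++⁻ˡ xs x∉ ∷ xs!′ , All.head (All.++⁻ʳ xs x∉) ∷ xs≢y

unique-map-injectiveOn : ∀ {P : ℕ → Set} {f : ℕ → ℕ} → (∀ {a b} → P a → P b → f a ≡ f b → a ≡ b) →
                         ∀ {xs} → All P xs → Unique xs → Unique (map f xs)
unique-map-injectiveOn inj []         []          = []
unique-map-injectiveOn inj (pa ∷ pxs) (a∉ ∷ xs!) =
  All.map⁺ (All.zipWith (λ (pb , a≢b) → a≢b ∘ inj pa pb) (pxs , a∉)) ∷ unique-map-injectiveOn inj pxs xs!

lower-injectiveOn : ∀ {c a b} → a ≢ c → b ≢ c → lower c a ≡ lower c b → a ≡ b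
lower-injectiveOn {c} a≢c b≢c eq = trans (sym (raise-lower a≢c)) (trans (cong (raise c) eq) (raise-lower b≢c))

lower-inRange : ∀ {n x y} → InRange (suc n) y → x ≢ y → InRange (suc n) x → InRange n (lower y x)
lower-inRange {n} {x} {y} (1≤y , y≤1+n) x≢y (1≤x , x≤1+n) with <-cmp x y
... | tri< x<y _ _ = subst (InRange n) (sym (lower-≤ (<⇒≤ x<y))) (1≤x , ≤-pred (≤-trans x<y y≤1+n))
... | tri≈ _ x≡y _ = ⊥-elim (x≢y x≡y)
... | tri> _ _ y<x = subst (InRange n) (sym (lower-> y<x))
                       (≤-trans 1≤y (∸-monoˡ-≤ 1 y<x) , ∸-monoˡ-≤ 1 x≤1+n)

module _ {n k xs y} (adm : Admissible (suc n) k (xs ∷ʳ y)) where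
  open Admissible adm

  init-length : length xs ≡ n
  init-length = suc-injective (trans (sym (length-∷ʳ xs y)) length≡)

  last-inRange : InRange (suc n) y
  last-inRange = All.head (All.++⁻ʳ xs inRange)

  last-distinct : All (_≢ y) xs
  last-distinct = proj₂ (unique-∷ʳ⁻ xs distinct)

  last-drop : suc n ≤ y + k
  last-drop = subst (_≤ y + k) (cong suc init-length)
                (≤-trans (m≤n+m∸n (suc (length xs)) y) (+-monoʳ-≤ y (proj₂ (maxdrop-∷ʳ xs y maxdrop≤))))

  Admissible-standardize : Admissible n k (standardize xs y)
  Admissible-standardize = record
    { length≡  = trans (length-map (lower y) xs) init-length
    ; inRange  = All.map⁺ (All.zipWith (λ (x≢y , x∈) → lower-inRange last-inRange x≢y x∈)
                                       (last-distinct , All.++⁻ˡ xs inRange))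
    ; distinct = unique-map-injectiveOn lower-injectiveOn last-distinct (proj₁ (unique-∷ʳ⁻ xs distinct))
    ; maxdrop≤ = maxdropFrom-standardize 1 xs (proj₂ (maxdrop-∷ʳ xs y maxdrop≤)) (proj₁ (maxdrop-∷ʳ xs y maxdrop≤))
    }

Admissible-one : ∀ {k xs y} → Admissible 1 k (xs ∷ʳ y) → xs ≡ [] × y ≡ 1
Admissible-one {xs = []} {y} adm = refl , ≤-antisym (proj₂ y∈) (proj₁ y∈)
  where
  y∈ : InRange 1 y
  y∈ = last-inRange {xs = []} adm
Admissible-one {xs = _ ∷ _}     adm with () ← init-length {xs = _ ∷ _} adm

initLast-∷ʳ : ∀ xs (y : ℕ) → initLast (xs ∷ʳ y) ≡ (xs , y)
initLast-∷ʳ []            y = refl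
initLast-∷ʳ (x ∷ [])      y = refl
initLast-∷ʳ (x ∷ x′ ∷ xs) y rewrite initLast-∷ʳ (x′ ∷ xs) y = refl

module _ (k : ℕ) where
  open Arithmetic k

  φAux-∷ʳ : ∀ m xs y → φAux k (suc (suc m)) (xs ∷ʳ y) ≡
                       φAux k (suc m) (standardize xs y) ← newLast (suc (suc m)) k (xs ∷ʳ y) y
  φAux-∷ʳ m xs y rewrite initLast-∷ʳ xs y = refl

  φAux-← : ∀ m σ c → φAux k (suc (suc m)) (σ ← c) ≡ φAux k (suc m) σ ← newLast (suc (suc m)) k (σ ← c) c
  φAux-← m σ c = trans (φAux-∷ʳ m (map (raise c) σ) c)
                       (cong (λ τ → φAux k (suc m) τ ← newLast (suc (suc m)) k (σ ← c) c) (standardize-raise c σ))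

  length-φAux : ∀ m π → length (φAux k (suc m) π) ≡ suc m
  length-φAux zero    π = refl
  length-φAux (suc m) π = trans (length-← σ c) (cong suc (length-φAux m π′))
    where
    π′ σ : List ℕ
    π′ = standardize (proj₁ (initLast π)) (proj₂ (initLast π))
    σ  = φAux k (suc m) π′
    c : ℕ
    c  = newLast (suc (suc m)) k π (proj₂ (initLast π))

  -- (q, r) are the paper's (i′, j′) for π = xs ∷ʳ y: φ(π) has q descents and ends in n − k + r.
  record φ-Stats (m : ℕ) (xs : List ℕ) (y : ℕ) : Set where
    field
      init      : List ℕ
      q r       : ℕ
      ends-in   : φAux k (suc m) (xs ∷ʳ y) ≡ init ∷ʳ newLast (suc m) k (xs ∷ʳ y) y
      des-φ     : des (φAux k (suc m) (xs ∷ʳ y)) ≡ q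
      balance   : Balanced (suc m) (des (xs ∷ʳ y)) y q r
      r≤k       : r ≤ k
      newLast+k : newLast (suc m) k (xs ∷ʳ y) y + k ≡ suc m + r

  φ-stats-step : ∀ {m xs x y} → Admissible (suc (suc m)) k (xs ∷ʳ x ∷ʳ y) →
                 φ-Stats m (standardize xs y) (lower y x) → φ-Stats (suc m) (xs ∷ʳ x) y
  φ-stats-step {m} {xs} {x} {y} adm stats = record
    { init      = map (raise c) (τ ∷ʳ c₀)
    ; q         = q
    ; r         = r
    ; ends-in   = φ≡
    ; des-φ     = des-φ≡
    ; balance   = bal
    ; r≤k       = r≤k
    ; newLast+k = c+k
    }
    where
    open φ-Stats stats using () renaming
      (init to τ; q to q₀; r to r₀; ends-in to ends-in₀; des-φ to des-φ₀; balance to bal₀; r≤k to r₀≤k;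
       newLast+k to c₀+k)
    open ≡-Reasoning
    π π′ : List ℕ
    π  = xs ∷ʳ x ∷ʳ y
    π′ = standardize xs y ∷ʳ lower y x
    adm′ : Admissible (suc m) k π′
    adm′ = subst (Admissible (suc m) k) (standardize-∷ʳ xs x y) (Admissible-standardize adm)
    successor : ∃ λ r → r ≤ k × Balanced (suc (suc m)) (des π′ + iverson (y <ᵇ x)) y (q₀ + iverson (r <ᵇ r₀)) r
    successor = balanced-successor bal₀ r₀≤k (All.head (All.++⁻ʳ xs (last-distinct adm)))
                  (<-≤-trans (s≤s (proj₂ (last-inRange adm′))) (last-drop adm))
                  (≤-trans (proj₂ (last-inRange adm)) (s≤s (last-drop adm′)))
    q r : ℕ
    r = proj₁ successor
    q = q₀ + iverson (r <ᵇ r₀)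
    r≤k : r ≤ k
    r≤k = proj₁ (proj₂ successor)
    bal : Balanced (suc (suc m)) (des π) y q r
    bal = subst (λ d → Balanced (suc (suc m)) d y q r)
                (sym (des-standardize-∷ʳ xs x y (last-distinct adm))) (proj₂ (proj₂ successor))
    c c₀ : ℕ
    c  = newLast (suc (suc m)) k π y
    c₀ = newLast (suc m) k π′ (lower y x)
    c+k : c + k ≡ suc (suc m) + r
    c+k = newLast-balanced π bal r≤k (k≤n+r bal (proj₁ (last-inRange adm)) (proj₂ (last-inRange adm)))
    φ≡ : φAux k (suc (suc m)) π ≡ (τ ∷ʳ c₀) ← c
    φ≡ = trans (φAux-∷ʳ m (xs ∷ʳ x) y)
               (cong (_← c) (trans (cong (φAux k (suc m)) (standardize-∷ʳ xs x y)) ends-in₀))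
    des-φ≡ : des (φAux k (suc (suc m)) π) ≡ q
    des-φ≡ = begin
      des (φAux k (suc (suc m)) π)               ≡⟨ cong des φ≡ ⟩
      des ((τ ∷ʳ c₀) ← c)                        ≡⟨ des-←-∷ʳ τ c₀ c ⟩
      des (τ ∷ʳ c₀) + iverson (c <ᵇ raise c c₀)  ≡⟨ cong₂ (λ a b → a + iverson b)
                                                      (trans (cong des (sym ends-in₀)) des-φ₀)
                                                      (trans (raise-self-<ᵇ c c₀) carry-bit) ⟩
      q                                          ∎
      where
      carry-bit : (c <ᵇ suc c₀) ≡ (r <ᵇ r₀)
      carry-bit = last-comparison {n = suc m} {r = r} {s = r₀} c+k c₀+k

  φ-stats : ∀ m xs y → Admissible (suc m) k (xs ∷ʳ y) → φ-Stats m xs y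
  φ-stats zero xs y adm with refl , refl ← Admissible-one adm = record
    { init      = []
    ; q         = 0
    ; r         = k
    ; ends-in   = cong (_∷ []) (sym (+-cancelʳ-≡ k _ 1 newLast+k))
    ; des-φ     = refl
    ; balance   = balanced-one
    ; r≤k       = ≤-refl
    ; newLast+k = newLast+k
    }
    where
    newLast+k : newLast 1 k (1 ∷ []) 1 + k ≡ 1 + k
    newLast+k = newLast-balanced (1 ∷ []) balanced-one ≤-refl (m≤n+m k 1)
  φ-stats (suc m) xs y adm with xs₀ , x , refl ← snoc-view xs (init-length adm) =
    φ-stats-step adm (φ-stats m (standardize xs₀ y) (lower y x)
                       (subst (Admissible (suc m) k) (standardize-∷ʳ xs₀ x y) (Admissible-standardize adm)))

  involutive : ∀ m {π} → Admissible (suc m) k π → φAux k (suc m) (φAux k (suc m) π) ≡ π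
  involutive zero {π} adm with xs , y , refl ← snoc-view π (Admissible.length≡ adm)
                          with refl , refl ← Admissible-one adm = refl
  involutive (suc m) {π} adm with xs , y , refl ← snoc-view π (Admissible.length≡ adm) = begin
    φAux k n (φAux k n (xs ∷ʳ y))              ≡⟨ cong (φAux k n) (φAux-∷ʳ m xs y) ⟩
    φAux k n (σ ← c)                           ≡⟨ φAux-← m σ c ⟩
    φAux k (suc m) σ ← newLast n k (σ ← c) c   ≡⟨ cong₂ _←_ (involutive m (Admissible-standardize adm)) last-returns ⟩
    standardize xs y ← y                       ≡⟨ cong (_∷ʳ y) (raise-standardize (last-distinct adm)) ⟩
    xs ∷ʳ y                                    ∎
    where
    open ≡-Reasoning
    open φ-Stats (φ-stats (suc m) xs y adm)
    n : ℕ
    n = suc (suc m)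
    σ : List ℕ
    σ = φAux k (suc m) (standardize xs y)
    c : ℕ
    c = newLast n k (xs ∷ʳ y) y
    last-returns : newLast n k (σ ← c) c ≡ y
    last-returns = newLast-involutive (σ ← c) (trans (cong des (sym (φAux-∷ʳ m xs y))) des-φ) balance newLast+k
                     (proj₂ (last-inRange adm)) (last-drop adm)

lemma2p3 : (n k : ℕ) → 1 ≤ n → (π : List ℕ) → InA n k π → φ k (φ k π) ≡ π
lemma2p3 (suc m) k _ π π∈A with adm ← InA⇒Admissible π∈A
  rewrite Admissible.length≡ adm | length-φAux k m π = involutive k m adm
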